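{- Let $G$ be a finite simple graph with a hole cover $\mathcal{C}$. Then $\mathcal{C}$ can be partitioned into sets $\mathcal{C}_1,\ldots,\mathcal{C}_k$ for some positive integer $k$ so that, with $G_0=G_0^*=G-\mathcal{C}$ and, for $i=1,\ldots,k$, $G_i$ the graph with $V(G_i)=V(G_{i-1}^*)\cup\mathcal{C}_i$ and $E(G_i)=E(G_{i-1}^*)\cup E\left(G-\bigcup_{j=i+1}^k\mathcal{C}_j\right)$, and $G_i^*=\widehat{G_i}(\mathcal{C}_i)$, the following hold for each $i=1,\ldots,k$: (i) $\mathcal{C}_i$ is a hole cover of $G_i$ satisfying the NC property in $G_i$; (ii) $G_i^*$ is chordal.
   Context: A hole of a graph is an induced cycle of length at least $4$; a graph is chordal if it has no hole. A nonempty set $X\subseteq V(G)$ is a hole cover of $G$ if every hole of $G$ contains a vertex of $X$ (for chordal $G$ every nonempty vertex set is a hole cover). A vertex $u$ satisfies the NC property in $G$ if no hole of $G$ containing $u$ and hole of $G$ not containing $u$ share two consecutive edges. A set $\mathcal{C}$ satisfies the NC property in $G$ if each vertex of $\mathcal{C}$ satisfies the NC property in $G$ and every hole of $G$ contains at most one vertex of $\mathcal{C}$. Locally chordalizing a hole $H$ by a vertex $u$ on $H$ means adding an edge $uv$ for every vertex $v$ of $H$ not adjacent to $u$. For a hole cover $\mathcal{C}=\{u_1,\ldots,u_m\}$ of a graph $F$ satisfying the NC property in $F$, $\widehat{F}(\mathcal{C})$ is obtained by setting $F_0=F$ and, for $i=1,\ldots,m$, obtaining $F_i$ from $F_{i-1}$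 by locally chordalizing simultaneously all holes of $F_{i-1}$ containing $u_i$ by $u_i$, and taking $F_m$ (this is independent of the ordering). The union over an empty index range is empty. -}

module Defs where

open import Data.Nat using (ℕ; zero; suc; _+_; _%_; _<_; _≤_; NonZero)
open import Data.Fin using (Fin; toℕ)
open import Data.Fin.Subset using (Subset; _∉_) renaming (_∈_ to _∈ₛ_)
open import Data.List using (List; []; _∷_)
open import Data.List.Membership.Propositional using (_∈_)
open import Data.Product using (Σ; ∃; _×_; _,_)
open import Data.Sum using (_⊎_)
open import Data.Empty using (⊥)
open import Data.Unit using (⊤)
open import Relation.Nullary using (¬_)
open import Relation.Binary.PropositionalEquality using (_≡_; _≢_)
open import Function.Bundles using (_⇔_)

record Graph (n : ℕ) : Set₁ where
  field
    V : Fin n → Set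
    E : Fin n → Fin n → Set
open Graph public

record SimpleGraph (n : ℕ) : Set₁ where
  field
    adj    : Fin n → Fin n → Set
    sym    : ∀ {x y} → adj x y → adj y x
    irrefl : ∀ {x} → ¬ adj x x
open SimpleGraph public

toGraph : ∀ {n} → SimpleGraph n → Graph n
toGraph G = record { V = λ _ → ⊤ ; E = adj G }

Consec : (m : ℕ) → .{{_ : NonZero m}} → Fin m → Fin m → Set
Consec m i j = (toℕ j ≡ suc (toℕ i) % m) ⊎ (toℕ i ≡ suc (toℕ j) % m)

-- A hole: distinct vertices vs 0, …, vs (m-1) of F (m ≥ 4), where two of
-- them are adjacent in F iff they are cyclically consecutive
-- (an induced cycle of length at least 4).
record Hole {n : ℕ} (F : Graph n) : Set where
  field
    len  : ℕ
    vs   : Fin (4 + len) → Fin n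
    inj  : ∀ i j → vs i ≡ vs j → i ≡ j
    inV  : ∀ i → V F (vs i)
    adjC : ∀ i j → (E F (vs i) (vs j) ⇔ Consec (4 + len) i j)
open Hole public

OnHole : ∀ {n} {F : Graph n} → Hole F → Fin n → Set
OnHole H v = ∃ λ i → vs H i ≡ v

Chordal : ∀ {n} → Graph n → Set
Chordal F = ¬ Hole F

HoleCover : ∀ {n} → Graph n → (Fin n → Set) → Set
HoleCover F X =
  (∃ λ x → X x) × (∀ x → X x → V F x) × (∀ (H : Hole F) → ∃ λ x → OnHole H x × X x)

-- ab is an edge of the hole H (H is induced, so its edges are exactly the
-- edges of F between vertices of H)
HoleEdge : ∀ {n} {F : Graph n} → Hole F → Fin n → Fin n → Set
HoleEdge {F = F} H a b = OnHole H a × OnHole H b × E F a b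

ShareTwoConsec : ∀ {n} {F : Graph n} → Hole F → Hole F → Set
ShareTwoConsec H₁ H₂ = ∃ λ a → ∃ λ b → ∃ λ c → a ≢ c ×
  HoleEdge H₁ a b × HoleEdge H₁ b c × HoleEdge H₂ a b × HoleEdge H₂ b c

NCVertex : ∀ {n} → Graph n → Fin n → Set
NCVertex F u = ∀ (H₁ H₂ : Hole F) → OnHole H₁ u → ¬ OnHole H₂ u → ¬ ShareTwoConsec H₁ H₂

NCSet : ∀ {n} → Graph n → (Fin n → Set) → Set
NCSet F X = (∀ u → X u → NCVertex F u) ×
  (∀ (H : Hole F) i j → X (vs H i) → X (vs H j) → vs H i ≡ vs H j)

LocalEdge : ∀ {n} → Graph n → Fin n → Fin n → Fin n → Set
LocalEdge F u x y = x ≡ u × y ≢ u × Σ (Hole F) (λ H → OnHole H u × OnHole H y)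

chordalizeAt : ∀ {n} → Graph n → Fin n → Graph n
chordalizeAt F u = record
  { V = V F
  ; E = λ x y → E F x y ⊎ LocalEdge F u x y ⊎ LocalEdge F u y x }

-- F̂(C) for C = u₁, …, u_m given as a list (processed in list order)
hat : ∀ {n} → Graph n → List (Fin n) → Graph n
hat F []       = F
hat F (u ∷ us) = hat (chordalizeAt F u) us

minus : ∀ {n} → SimpleGraph n → (Fin n → Set) → Graph n
minus G X = record
  { V = λ v → ¬ X v
  ; E = λ x y → adj G x y × ¬ X x × ¬ X y }

IsPartition : ∀ {n} → Subset n → (k : ℕ) → (ℕ → List (Fin n)) → Set
IsPartition C k P =
  (∀ i → 1 ≤ i → i ≤ k → ∃ λ v → v ∈ P i) ×
  (∀ i → 1 ≤ i → i ≤ k → ∀ v → v ∈ P i → v ∈ₛ C) ×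
  (∀ v → v ∈ₛ C → ∃ λ i → 1 ≤ i × i ≤ k × v ∈ P i) ×
  (∀ i j v → 1 ≤ i → i ≤ k → 1 ≤ j → j ≤ k → v ∈ P i → v ∈ P j → i ≡ j)

Later : ∀ {n} → (k : ℕ) → (ℕ → List (Fin n)) → ℕ → Fin n → Set
Later k P i v = ∃ λ j → i < j × j ≤ k × v ∈ P j

module Construction {n : ℕ} (G : SimpleGraph n) (C : Subset n)
                    (k : ℕ) (P : ℕ → List (Fin n)) where
  mutual
    -- G_i  (G_0 := G - C, only G_i for i ≥ 1 matters)
    Gi : ℕ → Graph n
    Gi zero    = minus G (_∈ₛ C)
    Gi (suc i) = record
      { V = λ v → V (Gstar i) v ⊎ v ∈ P (suc i)
      ; E = λ x y → E (Gstar i) x y ⊎ E (minus G (Later k P (suc i))) x y }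

    Gstar : ℕ → Graph n
    Gstar zero    = minus G (_∈ₛ C)
    Gstar (suc i) = hat (Gi (suc i)) (P (suc i))

module Submission where

-- Theorem 4.1.  Split the hole cover C into singletons {u₁}, …, {u_k}
-- (k = |C| ≥ 1, in increasing order).  G₀* = G − C is chordal because C meets
-- every hole of G.  If G*_{i-1} is chordal, then every hole of G_i passes
-- through u_i, since G_i − u_i is a subgraph of G*_{i-1}; hence {u_i} is a
-- hole cover of G_i, trivially with the NC property, and G_i* =
-- chordalizeAt G_i u_i is chordal by the main lemma (Chordalization):
--
--   if u lies on every hole of F, chordalizing all holes through u by u
--   leaves a chordal graph.
--
-- The main lemma rests on a hole criterion: p lies on a hole as soon as two
-- distinct non-adjacent neighbours of p are joined by a walk avoiding p and
-- its neighbours (shortcut the walk to an induced path and close it by p).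

open import Defs hiding (sym)
open import Data.Nat using (ℕ; zero; suc; _+_; _<_; _≤_; _%_; z≤n; s≤s)
open import Data.Nat.Properties using (suc-injective; <⇒≢; n≤1+n; ≤-trans; m≤n⇒m<n∨m≡n)
open import Data.Nat.DivMod using (m<n⇒m%n≡m; n%n≡0; m%n<n)
open import Data.Fin using (Fin; zero; suc; toℕ; fromℕ<; fromℕ; inject₁)
open import Data.Fin.Properties
  using (toℕ<n; toℕ-fromℕ<; toℕ-injective; toℕ-fromℕ; toℕ-inject₁; 0≢1+n; _≟_; any?)
  renaming (suc-injective to fin-suc-injective)
open import Data.Fin.Subset using (Subset) renaming (_∈_ to _∈ₛ_)
open import Data.Fin.Subset.Properties using () renaming (_∈?_ to _∈ₛ?_)
open import Data.List using (List; []; _∷_; _++_; [_]; reverse; length; tabulate; lookup; filter; allFin)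
open import Data.List.Properties using (++-assoc; unfold-reverse)
open import Data.List.Relation.Unary.All as All using (All; []; _∷_)
open import Data.List.Relation.Unary.All.Properties using (++⁺; ++⁻ˡ; ++⁻ʳ; ¬Any⇒All¬; tabulate⁺)
open import Data.List.Relation.Unary.Any as Any using (Any; here; there)
open import Data.List.Relation.Unary.Any.Properties using (reverse⁻)
open import Data.List.Relation.Unary.AllPairs using ([]; _∷_)
open import Data.List.Relation.Unary.First as First using (first)
open import Data.List.Relation.Unary.First.Properties using (toView)
open import Data.List.Relation.Unary.Unique.Propositional using (Unique)
open import Data.List.Relation.Unary.Unique.Propositional.Properties using (filter⁺; allFin⁺)
open import Data.List.Membership.Propositional using (_∈_)
open import Data.List.Membership.Propositional.Properties
  using (∈-++⁺ˡ; ∈-++⁺ʳ; ∈-∃++; ∈-lookup; ∈-tabulate⁺; ∈-tabulate⁻; ∈-filter⁺; ∈-filter⁻; ∈-allFin)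
open import Data.Product using (Σ; Σ-syntax; ∃; _×_; _,_; proj₁; proj₂)
open import Data.Sum as Sum using (_⊎_; inj₁; inj₂; swap)
open import Data.Empty using (⊥; ⊥-elim)
open import Data.Unit using (⊤; tt)
open import Function using (_∘_)
open import Function.Bundles using (_⇔_; mk⇔; Equivalence)
open import Function.Construct.Composition using () renaming (equivalence to ⇔-trans)
open import Function.Construct.Symmetry using (⇔-sym)
open import Relation.Nullary using (¬_; Dec; yes; no)
open import Relation.Nullary.Decidable using (¬¬-excluded-middle)
open import Relation.Binary.PropositionalEquality using (_≡_; _≢_; refl; sym; trans; cong; subst)

lastMatch : ∀ {A : Set} {P : A → Set} → (∀ x → Dec (P x)) → ∀ xs → Any P xs →
  Σ[ B ∈ List A ] Σ[ d ∈ A ] Σ[ D ∈ List A ] (xs ≡ B ++ d ∷ D × P d × All (λ z → ¬ P z) D)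
lastMatch P? (x ∷ xs) px with Any.any? P? xs
... | yes later with lastMatch P? xs later
...   | B , d , D , refl , pd , nD = x ∷ B , d , D , refl , pd , nD
lastMatch P? (x ∷ xs) (here px) | no none = [] , x , xs , refl , px , ¬Any⇒All¬ xs none
lastMatch P? (x ∷ xs) (there p) | no none = ⊥-elim (none p)

module InducedPath {A : Set} (R : A → A → Set) where

  Apart : A → A → Set
  Apart x z = x ≢ z × ¬ R x z

  Induced : List A → Set
  Induced []           = ⊤
  Induced (x ∷ [])     = ⊤
  Induced (x ∷ y ∷ zs) = x ≢ y × R x y × All (Apart x) zs × Induced (y ∷ zs)

  induced-tail : ∀ x xs → Induced (x ∷ xs) → Induced xs
  induced-tail x []       _              = tt
  induced-tail x (y ∷ zs) (_ , _ , _ , ip) = ip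

  induced-suffix : ∀ B D → Induced (B ++ D) → Induced D
  induced-suffix []      D ip = ip
  induced-suffix (x ∷ B) D ip = induced-suffix B D (induced-tail x (B ++ D) ip)

  induced-unique : ∀ xs → Induced xs → Unique xs
  induced-unique []           _                  = []
  induced-unique (x ∷ [])     _                  = [] ∷ []
  induced-unique (x ∷ y ∷ zs) ip@(x≢y , _ , apart , _) =
    (x≢y ∷ All.map proj₁ apart) ∷ induced-unique (y ∷ zs) (induced-tail x (y ∷ zs) ip)

  induced-suffix-at : ∀ B {xs d D b} → xs ≡ B ++ d ∷ D → Induced (xs ++ [ b ]) → Induced (d ∷ D ++ [ b ])
  induced-suffix-at B {d = d} {D} {b} refl ip = induced-suffix B _ (subst Induced (++-assoc B (d ∷ D) [ b ]) ip)

  induced-separated : ∀ As t B {c c′} → Induced (As ++ t ∷ B) → c ∈ As → c′ ∈ B → Apart c c′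
  induced-separated (a ∷ [])      t B (_ , _ , apart , _) (here refl) c′∈ = All.lookup apart c′∈
  induced-separated (a ∷ a₂ ∷ As) t B (_ , _ , apart , _) (here refl) c′∈ =
    All.lookup apart (∈-++⁺ʳ As (there c′∈))
  induced-separated (a ∷ As) t B ip (there c∈) c′∈ =
    induced-separated As t B (induced-tail a _ ip) c∈ c′∈

induced-transfer : ∀ {A : Set} {R R′ : A → A → Set} (Q : A → Set) →
  (∀ {x y} → Q x → Q y → R x y → R′ x y) → (∀ {x y} → Q x → Q y → R′ x y → R x y) →
  ∀ xs → All Q xs → InducedPath.Induced R xs → InducedPath.Induced R′ xs
induced-transfer Q to from []           _                 _ = tt
induced-transfer Q to from (x ∷ [])     _                 _ = tt
induced-transfer Q to from (x ∷ y ∷ zs) (qx ∷ qy ∷ qzs) (x≢y , r , apart , ip) =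
  x≢y , to qx qy r ,
  All.zipWith (λ { (qz , (x≢z , ¬r)) → x≢z , (λ r′ → ¬r (from qx qz r′)) }) (qzs , apart) ,
  induced-transfer Q to from (y ∷ zs) (qy ∷ qzs) ip

-- Walks: Walk a I b is a walk from a to b whose internal vertices, in order, are I.
module Walks {A : Set} (R : A → A → Set) where
  open InducedPath R

  infixr 5 _◂_ _++ʷ_

  data Walk : A → List A → A → Set where
    edge : ∀ {a b} → R a b → Walk a [] b
    _◂_  : ∀ {a c I b} → R a c → Walk c I b → Walk a (c ∷ I) b

  _++ʷ_ : ∀ {a I c J b} → Walk a I c → Walk c J b → Walk a (I ++ c ∷ J) b
  edge r   ++ʷ w′ = r ◂ w′
  (r ◂ w) ++ʷ w′ = r ◂ (w ++ʷ w′)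

  splitʷ : ∀ {a b c} I {J} → Walk a (I ++ c ∷ J) b → Walk a I c × Walk c J b
  splitʷ []      (r ◂ w) = edge r , w
  splitʷ (x ∷ I) (r ◂ w) with splitʷ I w
  ... | w₁ , w₂ = r ◂ w₁ , w₂

  inducedWalk : ∀ x M y → Induced (x ∷ M ++ [ y ]) → Walk x M y
  inducedWalk x []      y (_ , r , _ , _)  = edge r
  inducedWalk x (m ∷ M) y (_ , r , _ , ip) = r ◂ inducedWalk m M y ip

  module _ (symR : ∀ {x y} → R x y → R y x) where

    reverseʷ : ∀ {a I b} → Walk a I b → Walk b (reverse I) a
    reverseʷ (edge r) = edge (symR r)
    reverseʷ {a} {c ∷ I} (r ◂ w) =
      subst (λ J → Walk _ J a) (sym (unfold-reverse c I)) (reverseʷ w ++ʷ edge (symR r))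

  module Shortcut (irrR : ∀ {x} → ¬ R x x) (R? : ∀ x y → Dec (R x y))
                  (_≟_ : ∀ (x y : A) → Dec (x ≡ y)) where

    Touches : A → A → Set
    Touches x z = z ≡ x ⊎ R x z

    touches? : ∀ x z → Dec (Touches x z)
    touches? x z with z ≟ x | R? x z
    ... | yes z≡x | _      = yes (inj₁ z≡x)
    ... | no _    | yes xz = yes (inj₂ xz)
    ... | no z≢x  | no ¬xz = no λ { (inj₁ z≡x) → z≢x z≡x ; (inj₂ xz) → ¬xz xz }

    -- Extend an induced c–b path backwards by an edge ac: cut the path at the
    -- last vertex touching a.
    prepend : ∀ {S : A → Set} {a c b M} → a ≢ b → R a c → All S (c ∷ M) →
      Induced (c ∷ M ++ [ b ]) → Σ[ M′ ∈ List A ] All S M′ × Induced (a ∷ M′ ++ [ b ])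
    prepend {a = a} {b = b} a≢b ac sM ip with R? a b
    ... | yes ab = [] , [] , (a≢b , ab , [] , tt)
    prepend {S = S} {a} {c} {b} {M} a≢b ac sM ip | no ¬ab
      with lastMatch (touches? a) (c ∷ M) (here (inj₂ ac))
    ... | B , d , D , eq , touch , far with touch | ++⁻ʳ B (subst (All S) eq sM)
    ...   | inj₁ refl | _ ∷ sD = D , sD , induced-suffix-at B eq ip
    ...   | inj₂ ad   | sdD    = d ∷ D , sdD , (a≢d , ad , apart , induced-suffix-at B eq ip)
      where
      a≢d : a ≢ d
      a≢d refl = irrR ad
      apart : All (Apart a) (D ++ [ b ])
      apart = ++⁺ (All.map (λ ¬t → (λ a≡z → ¬t (inj₁ (sym a≡z))) , (λ az → ¬t (inj₂ az))) far)
                  ((a≢b , ¬ab) ∷ [])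

    shortcut : ∀ {S : A → Set} {a I b} → a ≢ b → Walk a I b → All S I →
      Σ[ M ∈ List A ] All S M × Induced (a ∷ M ++ [ b ])
    shortcut a≢b (edge r) _ = [] , [] , (a≢b , r , [] , tt)
    shortcut {b = b} a≢b (_◂_ {c = c} r w) (sc ∷ sI) with c ≟ b
    ... | yes refl = [] , [] , (a≢b , r , [] , tt)
    ... | no c≢b with shortcut c≢b w sI
    ...   | M , sM , ip = prepend a≢b r (sc ∷ sM) ip

module CyclicPositions where

  Adj : ℕ → ℕ → Set
  Adj a b = b ≡ suc a ⊎ a ≡ suc b

  adj-suc : ∀ {a b} → Adj (suc a) (suc b) ⇔ Adj a b
  adj-suc = mk⇔ (λ { (inj₁ e) → inj₁ (suc-injective e) ; (inj₂ e) → inj₂ (suc-injective e) })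
                (λ { (inj₁ e) → inj₁ (cong suc e) ; (inj₂ e) → inj₂ (cong suc e) })

  suc-mod : ∀ m x → x < suc m →
    (suc x < suc m × suc x % suc m ≡ suc x) ⊎ (suc x ≡ suc m × suc x % suc m ≡ 0)
  suc-mod m x x<m with m≤n⇒m<n∨m≡n x<m
  ... | inj₁ lt   = inj₁ (lt , m<n⇒m%n≡m lt)
  ... | inj₂ refl = inj₂ (refl , n%n≡0 (suc m))

  consec-suc : ∀ {m} (i j : Fin m) → Consec (suc m) (suc i) (suc j) ⇔ Adj (toℕ i) (toℕ j)
  consec-suc {m} i j = mk⇔ to from
    where
    to : Consec (suc m) (suc i) (suc j) → Adj (toℕ i) (toℕ j)
    to (inj₁ e) with suc-mod m (suc (toℕ i)) (toℕ<n (suc i))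
    ... | inj₁ (_ , q) = inj₁ (suc-injective (trans e q))
    ... | inj₂ (_ , q) with () ← trans e q
    to (inj₂ e) with suc-mod m (suc (toℕ j)) (toℕ<n (suc j))
    ... | inj₁ (_ , q) = inj₂ (suc-injective (trans e q))
    ... | inj₂ (_ , q) with () ← trans e q
    from : Adj (toℕ i) (toℕ j) → Consec (suc m) (suc i) (suc j)
    from (inj₁ e) with suc-mod m (suc (toℕ i)) (toℕ<n (suc i))
    ... | inj₁ (_ , q)  = inj₁ (trans (cong suc e) (sym q))
    ... | inj₂ (eq , _) = ⊥-elim (<⇒≢ (toℕ<n (suc j)) (trans (cong suc e) eq))
    from (inj₂ e) with suc-mod m (suc (toℕ j)) (toℕ<n (suc j))
    ... | inj₁ (_ , q)  = inj₂ (trans (cong suc e) (sym q))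
    ... | inj₂ (eq , _) = ⊥-elim (<⇒≢ (toℕ<n (suc i)) (trans (cong suc e) eq))

  consec-zero : ∀ {m} (j : Fin (suc m)) →
    Consec (suc (suc m)) zero (suc j) ⇔ (toℕ j ≡ 0 ⊎ toℕ j ≡ m)
  consec-zero {m} j = mk⇔ to from
    where
    one% : 1 % suc (suc m) ≡ 1
    one% = m<n⇒m%n≡m {n = suc (suc m)} (s≤s (s≤s z≤n))
    to : Consec (suc (suc m)) zero (suc j) → (toℕ j ≡ 0 ⊎ toℕ j ≡ m)
    to (inj₁ e) = inj₁ (suc-injective (trans e one%))
    to (inj₂ e) with suc-mod (suc m) (suc (toℕ j)) (toℕ<n (suc j))
    ... | inj₁ (_ , q)  with () ← trans e q
    ... | inj₂ (eq , _) = inj₂ (suc-injective (suc-injective eq))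
    from : (toℕ j ≡ 0 ⊎ toℕ j ≡ m) → Consec (suc (suc m)) zero (suc j)
    from (inj₁ e)    = inj₁ (trans (cong suc e) (sym one%))
    from (inj₂ e) = inj₂ (sym (trans (cong (λ z → suc (suc z) % suc (suc m)) e) (n%n≡0 (suc (suc m)))))

  ¬consec-zero-zero : ∀ {m} → ¬ Consec (suc (suc m)) zero zero
  ¬consec-zero-zero {m} (inj₁ e) with () ← trans e (m<n⇒m%n≡m {n = suc (suc m)} (s≤s (s≤s z≤n)))
  ¬consec-zero-zero {m} (inj₂ e) with () ← trans e (m<n⇒m%n≡m {n = suc (suc m)} (s≤s (s≤s z≤n)))

  next : ∀ {m} → Fin (suc m) → Fin (suc m)
  next {m} i = fromℕ< (m%n<n (suc (toℕ i)) (suc m))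

  toℕ-next : ∀ {m} (i : Fin (suc m)) → toℕ (next i) ≡ suc (toℕ i) % suc m
  toℕ-next {m} i = toℕ-fromℕ< (m%n<n (suc (toℕ i)) (suc m))

  suc-mod-injective : ∀ m x y → x < suc m → y < suc m → suc x % suc m ≡ suc y % suc m → x ≡ y
  suc-mod-injective m x y x<m y<m e with suc-mod m x x<m | suc-mod m y y<m
  ... | inj₁ (_ , p) | inj₁ (_ , q) = suc-injective (trans (sym p) (trans e q))
  ... | inj₁ (_ , p) | inj₂ (_ , q) with () ← trans (sym p) (trans e q)
  ... | inj₂ (_ , p) | inj₁ (_ , q) with () ← trans (sym q) (trans (sym e) p)
  ... | inj₂ (p , _) | inj₂ (q , _) = suc-injective (trans p (sym q))

  next-injective : ∀ {m} (i j : Fin (suc m)) → next i ≡ next j → i ≡ j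
  next-injective {m} i j e = toℕ-injective (suc-mod-injective m (toℕ i) (toℕ j) (toℕ<n i) (toℕ<n j)
    (trans (sym (toℕ-next i)) (trans (cong toℕ e) (toℕ-next j))))

  consec-next : ∀ {m} (i j : Fin (suc m)) → Consec (suc m) (next i) (next j) ⇔ Consec (suc m) i j
  consec-next {m} i j = mk⇔ (λ { (inj₁ e) → inj₁ (back i j e) ; (inj₂ e) → inj₂ (back j i e) })
                            (λ { (inj₁ e) → inj₁ (forth i j e) ; (inj₂ e) → inj₂ (forth j i e) })
    where
    back : ∀ a b → toℕ (next b) ≡ suc (toℕ (next a)) % suc m → toℕ b ≡ suc (toℕ a) % suc m
    back a b e = suc-mod-injective m (toℕ b) (suc (toℕ a) % suc m) (toℕ<n b) (m%n<n (suc (toℕ a)) (suc m))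
      (trans (sym (toℕ-next b)) (trans e (cong (λ z → suc z % suc m) (toℕ-next a))))
    forth : ∀ a b → toℕ b ≡ suc (toℕ a) % suc m → toℕ (next b) ≡ suc (toℕ (next a)) % suc m
    forth a b e = trans (toℕ-next b) (trans (cong (λ z → suc z % suc m) e)
                    (cong (λ z → suc z % suc m) (sym (toℕ-next a))))

  next-inject₁ : ∀ {m} (k : Fin (suc m)) → next (inject₁ k) ≡ suc k
  next-inject₁ {m} k = toℕ-injective (trans (toℕ-next (inject₁ k))
    (trans (cong (λ z → suc z % suc (suc m)) (toℕ-inject₁ k)) (m<n⇒m%n≡m (s≤s (toℕ<n k)))))

  next-last : ∀ {m} → next (fromℕ m) ≡ zero
  next-last {m} = toℕ-injective (trans (toℕ-next (fromℕ m))
    (trans (cong (λ z → suc z % suc m) (toℕ-fromℕ m)) (n%n≡0 (suc m))))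

open CyclicPositions

unique-lookup : ∀ {A : Set} (xs : List A) → Unique xs → ∀ i j → lookup xs i ≡ lookup xs j → i ≡ j
unique-lookup (x ∷ xs) _ zero zero _ = refl
unique-lookup (x ∷ xs) (x≢ ∷ _) zero (suc j) e = ⊥-elim (All.lookup x≢ (∈-lookup j) e)
unique-lookup (x ∷ xs) (x≢ ∷ _) (suc i) zero e = ⊥-elim (All.lookup x≢ (∈-lookup i) (sym e))
unique-lookup (x ∷ xs) (_ ∷ u) (suc i) (suc j) e = cong suc (unique-lookup xs u i j e)

tabulate-snoc : ∀ {A : Set} {k} (g : Fin (suc k) → A) →
  tabulate g ≡ tabulate (λ i → g (inject₁ i)) ++ [ g (fromℕ k) ]
tabulate-snoc {k = zero}  g = refl
tabulate-snoc {k = suc k} g = cong (g zero ∷_) (tabulate-snoc (λ i → g (suc i)))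

module HoleLists {n : ℕ} (F : Graph n) where
  open InducedPath (E F)

  induced-tabulate : ∀ {k} (g : Fin k → Fin n) → (∀ i j → g i ≡ g j → i ≡ j) →
    (∀ i j → E F (g i) (g j) ⇔ Adj (toℕ i) (toℕ j)) → Induced (tabulate g)
  induced-tabulate {zero}        g inj adj = _
  induced-tabulate {suc zero}    g inj adj = _
  induced-tabulate {suc (suc k)} g inj adj =
    (λ e → 0≢1+n (inj zero (suc zero) e)) , Equivalence.from (adj zero (suc zero)) (inj₁ refl) ,
    tabulate⁺ (λ i → (λ e → 0≢1+n (inj zero (suc (suc i)) e)) ,
                     (λ r → far i (Equivalence.to (adj zero (suc (suc i))) r))) ,
    induced-tabulate (λ i → g (suc i)) (λ i j e → fin-suc-injective (inj (suc i) (suc j) e))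
      (λ i j → ⇔-trans (adj (suc i) (suc j)) adj-suc)
    where
    far : ∀ (i : Fin k) → ¬ Adj 0 (suc (suc (toℕ i)))
    far i (inj₁ ())
    far i (inj₂ ())

  module _ (symE : ∀ {x y} → E F x y → E F y x) (irrE : ∀ {x} → ¬ E F x x) where

    induced-adj : ∀ L → Induced L → ∀ i j → E F (lookup L i) (lookup L j) ⇔ Adj (toℕ i) (toℕ j)
    induced-adj (x ∷ xs) ip zero zero = mk⇔ (λ r → ⊥-elim (irrE r)) (λ { (inj₁ ()) ; (inj₂ ()) })
    induced-adj (x ∷ xs) ip zero (suc j) = mk⇔ (λ r → inj₁ (cong suc (Equivalence.to (head-adj xs ip j) r)))
      (λ { (inj₁ e) → Equivalence.from (head-adj xs ip j) (suc-injective e) ; (inj₂ ()) })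
      where
      head-adj : ∀ xs → Induced (x ∷ xs) → ∀ j → E F x (lookup xs j) ⇔ (toℕ j ≡ 0)
      head-adj (y ∷ zs) (_ , r , _ , _) zero = mk⇔ (λ _ → refl) (λ _ → r)
      head-adj (y ∷ zs) (_ , _ , apart , _) (suc j) =
        mk⇔ (λ r → ⊥-elim (proj₂ (All.lookup apart (∈-lookup j)) r)) (λ ())
    induced-adj (x ∷ xs) ip (suc i) zero =
      ⇔-trans (mk⇔ symE symE) (⇔-trans (induced-adj (x ∷ xs) ip zero (suc i)) (mk⇔ swap swap))
    induced-adj (x ∷ xs) ip (suc i) (suc j) =
      ⇔-trans (induced-adj xs (induced-tail x xs ip) i j) (⇔-sym adj-suc)

    closeCycle : ∀ w x₁ x₂ x₃ rest → let L = x₁ ∷ x₂ ∷ x₃ ∷ rest in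
      Induced L → All (w ≢_) L →
      (∀ j → E F w (lookup L j) ⇔ (toℕ j ≡ 0 ⊎ suc (toℕ j) ≡ length L)) →
      All (V F) (w ∷ L) → Σ[ H ∈ Hole F ] vs H zero ≡ w
    closeCycle w x₁ x₂ x₃ rest ip w∉ ends inV = record
      { len  = length rest
      ; vs   = lookup (w ∷ L)
      ; inj  = unique-lookup (w ∷ L) (w∉ ∷ induced-unique L ip)
      ; inV  = λ i → All.lookup inV (∈-lookup i)
      ; adjC = adjK } , refl
      where
      L : List (Fin n)
      L = x₁ ∷ x₂ ∷ x₃ ∷ rest
      adjK : ∀ i j → E F (lookup (w ∷ L) i) (lookup (w ∷ L) j) ⇔ Consec (4 + length rest) i j
      adjK zero zero = mk⇔ (λ r → ⊥-elim (irrE r)) (λ c → ⊥-elim (¬consec-zero-zero {2 + length rest} c))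
      adjK zero (suc j) = ⇔-trans (ends j) (⇔-trans (mk⇔ shift unshift) (⇔-sym (consec-zero j)))
        where
        shift : toℕ j ≡ 0 ⊎ suc (toℕ j) ≡ length L → toℕ j ≡ 0 ⊎ toℕ j ≡ 2 + length rest
        shift = Sum.map₂ suc-injective
        unshift : toℕ j ≡ 0 ⊎ toℕ j ≡ 2 + length rest → toℕ j ≡ 0 ⊎ suc (toℕ j) ≡ length L
        unshift = Sum.map₂ (cong suc)
      adjK (suc i) zero = ⇔-trans (mk⇔ symE symE) (⇔-trans (adjK zero (suc i)) (mk⇔ swap swap))
      adjK (suc i) (suc j) = ⇔-trans (induced-adj L ip i j) (⇔-sym (consec-suc i j))

    lastAdj : ∀ w M y → All (λ z → ¬ E F w z) M → E F w y → ∀ j →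
      E F w (lookup (M ++ [ y ]) j) ⇔ (suc (toℕ j) ≡ length (M ++ [ y ]))
    lastAdj w []      y _        wy zero = mk⇔ (λ _ → refl) (λ _ → wy)
    lastAdj w (m ∷ M) y (¬wm ∷ _) wy zero = mk⇔ (λ r → ⊥-elim (¬wm r)) (λ e → ⊥-elim (nonempty M (suc-injective (sym e))))
      where
      nonempty : ∀ M → length (M ++ [ y ]) ≢ 0
      nonempty []      ()
      nonempty (_ ∷ _) ()
    lastAdj w (m ∷ M) y (_ ∷ ¬wM) wy (suc j) = ⇔-trans (lastAdj w M y ¬wM wy j) (mk⇔ (cong suc) suc-injective)

    endsAdj : ∀ w x M y → E F w x → All (λ z → ¬ E F w z) M → E F w y → ∀ j →
      E F w (lookup (x ∷ M ++ [ y ]) j) ⇔ (toℕ j ≡ 0 ⊎ suc (toℕ j) ≡ length (x ∷ M ++ [ y ]))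
    endsAdj w x M y wx ¬wM wy zero    = mk⇔ (λ _ → inj₁ refl) (λ _ → wx)
    endsAdj w x M y wx ¬wM wy (suc j) = ⇔-trans (lastAdj w M y ¬wM wy j)
      (mk⇔ (λ e → inj₂ (cong suc e)) (λ { (inj₂ e) → suc-injective e ; (inj₁ ()) }))

    closePath : ∀ w x M y → Induced (x ∷ M ++ [ y ]) → E F w x → All (λ z → ¬ E F w z) M → E F w y →
      ¬ E F x y → All (w ≢_) (x ∷ M ++ [ y ]) → All (V F) (w ∷ x ∷ M ++ [ y ]) → Σ[ H ∈ Hole F ] OnHole H w
    closePath w x [] y (_ , xy , _) wx ¬wM wy ¬xy w∉ inV = ⊥-elim (¬xy xy)
    closePath w x (m ∷ []) y ip wx ¬wM wy ¬xy w∉ inV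
      with H , start ← closeCycle w x m y [] ip w∉ (endsAdj w x (m ∷ []) y wx ¬wM wy) inV = H , zero , start
    closePath w x (m ∷ m′ ∷ M) y ip wx ¬wM wy ¬xy w∉ inV
      with H , start ← closeCycle w x m m′ (M ++ [ y ]) ip w∉ (endsAdj w x (m ∷ m′ ∷ M) y wx ¬wM wy) inV
      = H , zero , start

  record Reading (H : Hole F) (w : Fin n) : Set where
    field
      x y      : Fin n
      M        : List (Fin n)
      induced  : Induced (x ∷ M ++ [ y ])
      wx       : E F w x
      ¬wM      : All (λ z → ¬ E F w z) M
      wy       : E F w y
      ¬xy      : ¬ E F x y
      w∉       : All (w ≢_) (x ∷ M ++ [ y ])
      inGraph  : All (V F) (x ∷ M ++ [ y ])
      onPath   : ∀ v → OnHole H v → v ≡ w ⊎ v ∈ x ∷ M ++ [ y ]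
      onHole   : ∀ v → v ∈ x ∷ M ++ [ y ] → OnHole H v

  readFromStart : (H : Hole F) → ∀ w → vs H zero ≡ w → Reading H w
  readFromStart H w refl = record
    { x = g (suc zero) ; M = Mt ; y = g (suc last)
    ; induced = subst Induced splitT inducedT
    ; wx = Equivalence.from (adjC H zero (suc zero)) (Equivalence.from (consec-zero {2 + len H} zero) (inj₁ refl))
    ; ¬wM = tabulate⁺ λ i r → inner i (Equivalence.to (consec-zero (suc (inject₁ i)))
                                        (Equivalence.to (adjC H zero (suc (suc (inject₁ i)))) r))
    ; wy = Equivalence.from (adjC H zero (suc last)) (Equivalence.from (consec-zero last)
             (inj₂ (cong suc (toℕ-fromℕ (suc l)))))
    ; ¬xy = λ r → ends-apart (Equivalence.to (consec-suc zero last) (Equivalence.to (adjC H (suc zero) (suc last)) r))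
    ; w∉ = subst (All (g zero ≢_)) splitT (tabulate⁺ λ k e → 0≢1+n (inj H zero (suc k) e))
    ; inGraph = subst (All (V F)) splitT (tabulate⁺ λ k → inV H (suc k))
    ; onPath = onPath
    ; onHole = onHole }
    where
    l : ℕ
    l = len H
    g : Fin (4 + l) → Fin n
    g = vs H
    T : List (Fin n)
    T = tabulate (λ (k : Fin (3 + l)) → g (suc k))
    Mt : List (Fin n)
    Mt = tabulate (λ (i : Fin (suc l)) → g (suc (suc (inject₁ i))))
    last : Fin (3 + l)
    last = suc (fromℕ (suc l))
    splitT : T ≡ g (suc zero) ∷ Mt ++ [ g (suc last) ]
    splitT = cong (g (suc zero) ∷_) (tabulate-snoc (λ k → g (suc (suc k))))
    inducedT : Induced T
    inducedT = induced-tabulate (λ k → g (suc k)) (λ i j e → fin-suc-injective (inj H (suc i) (suc j) e))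
      (λ i j → ⇔-trans (adjC H (suc i) (suc j)) (consec-suc i j))
    inner : ∀ (i : Fin (suc l)) → ¬ (toℕ (suc (inject₁ i)) ≡ 0 ⊎ toℕ (suc (inject₁ i)) ≡ 2 + l)
    inner i (inj₁ ())
    inner i (inj₂ e) = <⇒≢ (toℕ<n i) (trans (sym (toℕ-inject₁ i)) (suc-injective e))
    ends-apart : ¬ Adj 0 (toℕ last)
    ends-apart a rewrite toℕ-fromℕ (suc l) with a
    ... | inj₁ ()
    ... | inj₂ ()
    onPath : ∀ v → OnHole H v → v ≡ g zero ⊎ v ∈ g (suc zero) ∷ Mt ++ [ g (suc last) ]
    onPath v (zero , e)  = inj₁ (sym e)
    onPath v (suc k , e) = inj₂ (subst (v ∈_) splitT (subst (_∈ T) e (∈-tabulate⁺ {f = λ (k : Fin (3 + l)) → g (suc k)} k)))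
    onHole : ∀ v → v ∈ g (suc zero) ∷ Mt ++ [ g (suc last) ] → OnHole H v
    onHole v i with k , e ← ∈-tabulate⁻ (subst (v ∈_) (sym splitT) i) = suc k , sym e

  rotate : Hole F → Hole F
  rotate H = record
    { len  = len H
    ; vs   = λ i → vs H (next i)
    ; inj  = λ i j e → next-injective i j (inj H (next i) (next j) e)
    ; inV  = λ i → inV H (next i)
    ; adjC = λ i j → ⇔-trans (adjC H (next i) (next j)) (consec-next i j) }

  rotateTo : ∀ t (H : Hole F) (i : Fin (4 + len H)) → toℕ i ≡ t →
    Σ[ H′ ∈ Hole F ] vs H′ zero ≡ vs H i × (∀ v → OnHole H v → OnHole H′ v)
  rotateTo _       H zero    _ = H , refl , λ v o → o
  rotateTo (suc t) H (suc k) e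
    with H′ , start , keep ← rotateTo t (rotate H) (inject₁ k) (trans (toℕ-inject₁ k) (suc-injective e))
    = H′ , trans start (cong (vs H) (next-inject₁ k)) , λ v o → keep v (onRotated v o)
    where
    onRotated : ∀ v → OnHole H v → OnHole (rotate H) v
    onRotated v (zero , e)  = fromℕ _ , trans (cong (vs H) next-last) e
    onRotated v (suc q , e) = inject₁ q , trans (cong (vs H) (next-inject₁ q)) e

  readAt : (H : Hole F) → ∀ w → OnHole H w →
    Σ[ H′ ∈ Hole F ] Reading H′ w × (∀ v → OnHole H v → OnHole H′ v)
  readAt H w (i , e) with H′ , start , keep ← rotateTo (toℕ i) H i refl =
    H′ , readFromStart H′ w (trans start e) , keep

all-reverse : ∀ {A : Set} {P : A → Set} {xs} → All P xs → All P (reverse xs)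
all-reverse {xs = xs} pxs = All.tabulate (λ z∈ → All.lookup pxs (reverse⁻ z∈))

transferHole : ∀ {n} {F₁ F₂ : Graph n} (H : Hole F₁) → (∀ i → V F₂ (vs H i)) →
  (∀ i j → E F₂ (vs H i) (vs H j) ⇔ E F₁ (vs H i) (vs H j)) → Hole F₂
transferHole H inV₂ same = record
  { len = len H ; vs = vs H ; inj = inj H ; inV = inV₂
  ; adjC = λ i j → ⇔-trans (same i j) (adjC H i j) }

-- Call v joined to u if uv is an edge of F* = chordalizeAt F u.  A hole of F*
-- avoiding u would be a hole of F, so a hole of F* reads u x p … y, where x
-- and y are joined to u and p is not.  Every vertex joined to u has a walk to
-- u avoiding p (escape), so x reaches the second neighbour of p on the hole
-- by a walk x ⇝ u ⇝ y ⇝ … avoiding p, and the hole criterion puts p on a hole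
-- of F; since that hole passes through u, p would be joined to u.
module Chordalization {n : ℕ} (F : Graph n) (u : Fin n)
    (symE : ∀ {x y} → E F x y → E F y x) (irrE : ∀ {x} → ¬ E F x x)
    (E? : ∀ x y → Dec (E F x y)) (uV : V F u) (cover : ∀ (H : Hole F) → OnHole H u) where
  open InducedPath (E F)
  open Walks (E F)
  open Shortcut irrE E? _≟_
  open HoleLists F

  F* : Graph n
  F* = chordalizeAt F u

  -- v is a neighbour of u or lies on a hole through u
  Joined : Fin n → Set
  Joined v = E F* u v

  joined-on-hole : ∀ {p} → p ≢ u → Σ[ H ∈ Hole F ] OnHole H p → Joined p
  joined-on-hole p≢u (H , onp) = inj₂ (inj₁ (refl , p≢u , H , cover H , onp))

  Avoids : Fin n → Fin n → Set
  Avoids p v = V F v × v ≢ p × ¬ E F p v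

  avoids : ∀ {p v} → V F v → ¬ Touches p v → Avoids p v
  avoids vV ¬t = vV , (λ v≡p → ¬t (inj₁ v≡p)) , (λ pv → ¬t (inj₂ pv))

  centre-avoids : ∀ {p} → ¬ Joined p → p ≢ u → Avoids p u
  centre-avoids ¬Jp p≢u = uV , (λ u≡p → p≢u (sym u≡p)) , (λ pu → ¬Jp (inj₁ (symE pu)))

  Detour : Fin n → Fin n → Fin n → Set
  Detour p a b = Σ[ I ∈ List (Fin n) ] Walk a I b × All (Avoids p) I

  detour-reverse : ∀ {p a b} → Detour p a b → Detour p b a
  detour-reverse (I , w , avoid) = reverse I , reverseʷ symE w , all-reverse avoid

  detour-++ : ∀ {p a b c} → Detour p a b → Avoids p b → Detour p b c → Detour p a c
  detour-++ (I , w , avoidI) avoid-b (J , w′ , avoidJ) = I ++ _ ∷ J , w ++ʷ w′ , ++⁺ avoidI (avoid-b ∷ avoidJ)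

  holeCriterion : ∀ {p a b} → V F p → V F a → V F b → E F p a → E F p b → Apart a b →
    Detour p a b → Σ[ H ∈ Hole F ] OnHole H p
  holeCriterion {p} {a} {b} pV aV bV pa pb (a≢b , ¬ab) (I , w , avoid)
    with M , avoidM , ip ← shortcut a≢b w avoid
    = closePath symE irrE p a M b ip pa (All.map (proj₂ ∘ proj₂) avoidM) pb ¬ab p∉
        (pV ∷ aV ∷ ++⁺ (All.map proj₁ avoidM) (bV ∷ []))
    where
    neighbour : ∀ {v} → E F p v → p ≢ v
    neighbour pv refl = irrE pv
    p∉ : All (p ≢_) (a ∷ M ++ [ b ])
    p∉ = neighbour pa ∷ ++⁺ (All.map (λ av p≡v → proj₁ (proj₂ av) (sym p≡v)) avoidM) (neighbour pb ∷ [])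

  -- each vertex does or does not touch p (the form used by `first`)
  touch-or-not : ∀ p z → ¬ Touches p z ⊎ Touches p z
  touch-or-not p z with touches? p z
  ... | yes t = inj₂ t
  ... | no ¬t = inj₁ ¬t

  -- Every vertex t joined to u escapes to u avoiding any p not joined to u: go
  -- around a hole through t and u in a direction that misses the neighbours
  -- of p.  If both directions met a neighbour of p, the neighbours c, c′
  -- closest to u on either side are apart, and the detour c ⇝ u ⇝ c′ would
  -- put p on a hole.
  escape : ∀ {t p} → Joined t → t ≢ u → ¬ Joined p → p ≢ u → V F p → Detour p t u
  escape (inj₁ ut) _ _ _ _ = [] , edge (symE ut) , []
  escape (inj₂ (inj₂ (t≡u , _))) t≢u _ _ _ = ⊥-elim (t≢u t≡u)
  escape {t} {p} (inj₂ (inj₁ (_ , _ , C , onu , ont))) t≢u ¬Jp p≢u pV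
    with C′ , reading , keep ← readAt C u onu = aroundHole
    where
    open Reading reading
    L : List (Fin n)
    L = x ∷ M ++ [ y ]
    cycle : Walk u L u
    cycle = wx ◂ (inducedWalk x M y induced ++ʷ edge (symE wy))
    t∈L : t ∈ L
    t∈L with onPath t (keep t ont)
    ... | inj₁ t≡u = ⊥-elim (t≢u t≡u)
    ... | inj₂ t∈  = t∈
    -- p itself is not on the hole, as it is not joined to u
    touching : ∀ {z} → z ∈ L → Touches p z → E F p z
    touching z∈ (inj₁ refl) = ⊥-elim (¬Jp (joined-on-hole p≢u (C′ , onHole _ z∈)))
    touching z∈ (inj₂ pz)   = pz
    avoidsAll : ∀ K → (∀ {z} → z ∈ K → z ∈ L) → All (λ z → ¬ Touches p z) K → All (Avoids p) K
    avoidsAll K K⊆L ¬t = All.tabulate λ z∈ → avoids (All.lookup inGraph (K⊆L z∈)) (All.lookup ¬t z∈)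
    aroundHole : Detour p t u
    aroundHole with A , B , L≡ ← ∈-∃++ t∈L
      with splitʷ A (subst (λ K → Walk u K u) L≡ cycle) | first (touch-or-not p) A
    ... | wA , wB | inj₂ ¬tA = detour-reverse (A , wA , avoidsAll A inA ¬tA)
      where
      inA : ∀ {z} → z ∈ A → z ∈ L
      inA z∈ = subst (_ ∈_) (sym L≡) (∈-++⁺ˡ z∈)
    ... | wA , wB | inj₁ firstA with Any.any? (touches? p) B
    ...   | no ¬anyB = B , wB , avoidsAll B inB (¬Any⇒All¬ B ¬anyB)
      where
      inB : ∀ {z} → z ∈ B → z ∈ L
      inB z∈ = subst (_ ∈_) (sym L≡) (∈-++⁺ʳ A (there z∈))
    ...   | yes anyB with toView firstA | lastMatch (touches? p) B anyB
    ...     | First._++_∷_ {A₁} {c} ¬tA₁ tc A₂ | B₁ , c′ , B₂ , B≡ , tc′ , ¬tB₂ =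
      ⊥-elim (¬Jp (joined-on-hole p≢u (holeCriterion pV (All.lookup inGraph c∈L) (All.lookup inGraph c′∈L)
        (touching c∈L tc) (touching c′∈L tc′) apart (detour-++ c⇝u (centre-avoids ¬Jp p≢u) u⇝c′))))
      where
      c∈L : c ∈ L
      c∈L = subst (c ∈_) (sym L≡) (∈-++⁺ˡ (∈-++⁺ʳ A₁ (here refl)))
      c′∈B : c′ ∈ B
      c′∈B = subst (c′ ∈_) (sym B≡) (∈-++⁺ʳ B₁ (here refl))
      c′∈L : c′ ∈ L
      c′∈L = subst (c′ ∈_) (sym L≡) (∈-++⁺ʳ (A₁ ++ c ∷ A₂) (there c′∈B))
      apart : Apart c c′
      apart = induced-separated (A₁ ++ c ∷ A₂) t B (subst Induced L≡ induced) (∈-++⁺ʳ A₁ (here refl)) c′∈B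
      inA₁ : ∀ {z} → z ∈ A₁ → z ∈ L
      inA₁ z∈ = subst (_ ∈_) (sym L≡) (∈-++⁺ˡ (∈-++⁺ˡ z∈))
      inB₂ : ∀ {z} → z ∈ B₂ → z ∈ L
      inB₂ z∈ = subst (_ ∈_) (sym L≡) (∈-++⁺ʳ (A₁ ++ c ∷ A₂) (there (subst (_ ∈_) (sym B≡) (∈-++⁺ʳ B₁ (there z∈)))))
      c⇝u : Detour p c u
      c⇝u = detour-reverse (A₁ , proj₁ (splitʷ A₁ wA) , avoidsAll A₁ inA₁ ¬tA₁)
      u⇝c′ : Detour p u c′
      u⇝c′ = detour-reverse (B₂ , proj₂ (splitʷ B₁ (subst (λ K → Walk t K u) B≡ wB)) , avoidsAll B₂ inB₂ ¬tB₂)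

  edge-away : ∀ {x y} → x ≢ u → y ≢ u → E F* x y → E F x y
  edge-away _   _   (inj₁ xy)               = xy
  edge-away x≢u _   (inj₂ (inj₁ (x≡u , _))) = ⊥-elim (x≢u x≡u)
  edge-away _   y≢u (inj₂ (inj₂ (y≡u , _))) = ⊥-elim (y≢u y≡u)

  -- p has neighbours x and q on the induced path x p q … y of F; the detour
  -- x ⇝ u ⇝ y, continued back along the path to q, avoids p.
  hole-at-second : ∀ {x p y} P → Induced (x ∷ p ∷ P ++ [ y ]) → All (V F) (x ∷ p ∷ P ++ [ y ]) →
    Detour p x y → Σ[ H ∈ Hole F ] OnHole H p
  hole-at-second [] (_ , xp , apart ∷ [] , (_ , py , _)) (xV ∷ pV ∷ yV ∷ []) x⇝y =
    holeCriterion pV xV yV (symE xp) py apart x⇝y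
  hole-at-second {x} {p} {y} (q ∷ P) (_ , xp , apart ∷ _ , (_ , pq , apart-p , ip)) (xV ∷ pV ∷ qV ∷ restV) x⇝y =
    holeCriterion pV xV qV (symE xp) pq apart
      (detour-++ x⇝y (All.head (++⁻ʳ P avoid)) (detour-reverse (P , inducedWalk q P y ip , ++⁻ˡ P avoid)))
    where
    avoidsApart : ∀ {v} → V F v × Apart p v → Avoids p v
    avoidsApart (vV , p≢v , ¬pv) = vV , (λ v≡p → p≢v (sym v≡p)) , ¬pv
    avoid : All (Avoids p) (P ++ [ y ])
    avoid = All.zipWith avoidsApart (restV , apart-p)

  chordalized : Chordal F*
  chordalized H with any? (λ i → vs H i ≟ u)
  ... | no u∉H = u∉H (cover (transferHole H (inV H) λ i j →
                        mk⇔ inj₁ (edge-away (λ e → u∉H (i , e)) (λ e → u∉H (j , e)))))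
  ... | yes onu with _ , reading , _ ← HoleLists.readAt F* H u onu = throughU M induced ¬wM inGraph w∉
    where
    open HoleLists.Reading reading
    throughU : ∀ M → InducedPath.Induced (E F*) (x ∷ M ++ [ y ]) → All (λ z → ¬ Joined z) M →
      All (V F) (x ∷ M ++ [ y ]) → All (u ≢_) (x ∷ M ++ [ y ]) → ⊥
    throughU [] (_ , xy , _) _ _ _ = ¬xy xy
    throughU (p ∷ P) induced* (¬Jp ∷ _) inG w∉ =
      ¬Jp (joined-on-hole p≢u (hole-at-second P inducedF inG
        (detour-++ (escape′ (here refl) wx) (centre-avoids ¬Jp p≢u) (detour-reverse (escape′ y∈ wy)))))
      where
      away : ∀ {v} → v ∈ x ∷ p ∷ P ++ [ y ] → v ≢ u
      away v∈ v≡u = All.lookup w∉ v∈ (sym v≡u)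
      p≢u : p ≢ u
      p≢u = away (there (here refl))
      y∈ : y ∈ x ∷ p ∷ P ++ [ y ]
      y∈ = there (there (∈-++⁺ʳ P (here refl)))
      escape′ : ∀ {v} → v ∈ x ∷ p ∷ P ++ [ y ] → Joined v → Detour p v u
      escape′ v∈ Jv = escape Jv (away v∈) ¬Jp p≢u (All.lookup inG (there (here refl)))
      inducedF : Induced (x ∷ p ∷ P ++ [ y ])
      inducedF = induced-transfer (_≢ u) edge-away (λ _ _ → inj₁) _ (All.map (λ u≢ e → u≢ (sym e)) w∉) induced*

¬¬-∀-Fin : ∀ {n} {P : Fin n → Set} → (∀ x → ¬ ¬ P x) → ¬ ¬ (∀ x → P x)
¬¬-∀-Fin {zero}  h k = k (λ ())
¬¬-∀-Fin {suc n} {P} h k = h zero λ p₀ →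
  ¬¬-∀-Fin {n} {λ x → P (suc x)} (λ x → h (suc x)) λ ps → k λ { zero → p₀ ; (suc x) → ps x }

-- Any relation on a finite set is decidable up to double negation; this is
-- all we need to refute the existence of a hole.
¬¬-decidable : ∀ {n} (R : Fin n → Fin n → Set) → ¬ ¬ (∀ x y → Dec (R x y))
¬¬-decidable R = ¬¬-∀-Fin λ x → ¬¬-∀-Fin λ y → ¬¬-excluded-middle

module _ {n : ℕ} where

  Symmetric : Graph n → Set
  Symmetric F = ∀ {x y} → E F x y → E F y x

  Irreflexive : Graph n → Set
  Irreflexive F = ∀ {x} → ¬ E F x x

  chordalizeAt-symmetric : ∀ F u → Symmetric F → Symmetric (chordalizeAt F u)
  chordalizeAt-symmetric F u s (inj₁ xy)        = inj₁ (s xy)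
  chordalizeAt-symmetric F u s (inj₂ (inj₁ ℓ)) = inj₂ (inj₂ ℓ)
  chordalizeAt-symmetric F u s (inj₂ (inj₂ ℓ)) = inj₂ (inj₁ ℓ)

  chordalizeAt-irreflexive : ∀ F u → Irreflexive F → Irreflexive (chordalizeAt F u)
  chordalizeAt-irreflexive F u i (inj₁ xx)                   = i xx
  chordalizeAt-irreflexive F u i (inj₂ (inj₁ (x≡u , x≢u , _))) = x≢u x≡u
  chordalizeAt-irreflexive F u i (inj₂ (inj₂ (x≡u , x≢u , _))) = x≢u x≡u

  hat-symmetric : ∀ F us → Symmetric F → Symmetric (hat F us)
  hat-symmetric F []       s = s
  hat-symmetric F (u ∷ us) s = hat-symmetric (chordalizeAt F u) us (chordalizeAt-symmetric F u s)

  hat-irreflexive : ∀ F us → Irreflexive F → Irreflexive (hat F us)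
  hat-irreflexive F []       i = i
  hat-irreflexive F (u ∷ us) i = hat-irreflexive (chordalizeAt F u) us (chordalizeAt-irreflexive F u i)

  hat-mono : ∀ F (us : List (Fin n)) {x y} → E F x y → E (hat F us) x y
  hat-mono F []       xy = xy
  hat-mono F (u ∷ us) xy = hat-mono (chordalizeAt F u) us (inj₁ xy)

  -- The main lemma for a single vertex, without any decidability assumption.
  chordalizeAt-chordal : ∀ F u → Symmetric F → Irreflexive F → V F u →
    (∀ (H : Hole F) → OnHole H u) → Chordal (chordalizeAt F u)
  chordalizeAt-chordal F u s i uV cover H =
    ¬¬-decidable (E F) λ E? → Chordalization.chordalized F u s i E? uV cover H

-- The i-th entry of a list as a one-element list (empty when out of range).
module _ {A : Set} where

  slot : List A → ℕ → List A
  slot []       _       = []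
  slot (x ∷ xs) zero    = [ x ]
  slot (x ∷ xs) (suc i) = slot xs i

  slot-singleton : ∀ xs i → i < length xs → Σ[ x ∈ A ] slot xs i ≡ [ x ]
  slot-singleton (x ∷ xs) zero    _         = x , refl
  slot-singleton (x ∷ xs) (suc i) (s≤s i<n) = slot-singleton xs i i<n

  slot-⊆ : ∀ xs i {v} → v ∈ slot xs i → v ∈ xs
  slot-⊆ (x ∷ xs) zero    (here refl) = here refl
  slot-⊆ (x ∷ xs) (suc i) v∈          = there (slot-⊆ xs i v∈)

  slot-cover : ∀ xs {v} → v ∈ xs → Σ[ i ∈ ℕ ] i < length xs × v ∈ slot xs i
  slot-cover (x ∷ xs) (here refl) = zero , s≤s z≤n , here refl
  slot-cover (x ∷ xs) (there v∈) with i , i<n , v∈′ ← slot-cover xs v∈ = suc i , s≤s i<n , v∈′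

  slot-unique : ∀ xs → Unique xs → ∀ i j {v} → v ∈ slot xs i → v ∈ slot xs j → i ≡ j
  slot-unique (x ∷ xs) _          zero    zero    _           _           = refl
  slot-unique (x ∷ xs) (x∉ ∷ _)   zero    (suc j) (here refl) v∈          = ⊥-elim (All.lookup x∉ (slot-⊆ xs j v∈) refl)
  slot-unique (x ∷ xs) (x∉ ∷ _)   (suc i) zero    v∈          (here refl) = ⊥-elim (All.lookup x∉ (slot-⊆ xs i v∈) refl)
  slot-unique (x ∷ xs) (_ ∷ uxs)  (suc i) (suc j) v∈          v∈′         = cong suc (slot-unique xs uxs i j v∈ v∈′)

module SingletonPartition {n : ℕ} (G : SimpleGraph n) (C : Subset n) where

  members : List (Fin n)
  members = filter (_∈ₛ? C) (allFin n)

  k : ℕ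
  k = length members

  part : ℕ → List (Fin n)
  part zero    = []
  part (suc i) = slot members i

  open Construction G C k part

  member⇒∈ : ∀ {v} → v ∈ members → v ∈ₛ C
  member⇒∈ v∈ = proj₂ (∈-filter⁻ (_∈ₛ? C) {xs = allFin n} v∈)

  ∈⇒member : ∀ {v} → v ∈ₛ C → v ∈ members
  ∈⇒member {v} v∈C = ∈-filter⁺ (_∈ₛ? C) (∈-allFin v) v∈C

  partition : IsPartition C k part
  partition =
    (λ { (suc i) _ i<k → let (u , P≡) = slot-singleton members i i<k in u , subst (u ∈_) (sym P≡) (here refl) }) ,
    (λ { (suc i) _ _ v v∈ → member⇒∈ (slot-⊆ members i v∈) }) ,
    (λ v v∈C → let (i , i<k , v∈′) = slot-cover members (∈⇒member v∈C) in suc i , s≤s z≤n , i<k , v∈′) ,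
    (λ { (suc i) (suc j) v _ _ _ _ v∈ v∈′ → cong suc (slot-unique members (filter⁺ (_∈ₛ? C) (allFin⁺ n)) i j v∈ v∈′) })

  nonempty : (∃ λ x → x ∈ₛ C) → 1 ≤ k
  nonempty (x , x∈C) = nonempty-list (∈⇒member x∈C)
    where
    nonempty-list : ∀ {A : Set} {x : A} {xs} → x ∈ xs → 1 ≤ length xs
    nonempty-list (here _)  = s≤s z≤n
    nonempty-list (there _) = s≤s z≤n

  mutual
    Gi-symmetric : ∀ i → Symmetric (Gi i)
    Gi-symmetric zero    (xy , x∉ , y∉)        = SimpleGraph.sym G xy , y∉ , x∉
    Gi-symmetric (suc i) (inj₁ xy)             = inj₁ (Gstar-symmetric i xy)
    Gi-symmetric (suc i) (inj₂ (xy , x∉ , y∉)) = inj₂ (SimpleGraph.sym G xy , y∉ , x∉)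

    Gstar-symmetric : ∀ i → Symmetric (Gstar i)
    Gstar-symmetric zero    (xy , x∉ , y∉) = SimpleGraph.sym G xy , y∉ , x∉
    Gstar-symmetric (suc i) = hat-symmetric (Gi (suc i)) (part (suc i)) (Gi-symmetric (suc i))

  mutual
    Gi-irreflexive : ∀ i → Irreflexive (Gi i)
    Gi-irreflexive zero    (xx , _)        = irrefl G xx
    Gi-irreflexive (suc i) (inj₁ xx)       = Gstar-irreflexive i xx
    Gi-irreflexive (suc i) (inj₂ (xx , _)) = irrefl G xx

    Gstar-irreflexive : ∀ i → Irreflexive (Gstar i)
    Gstar-irreflexive zero    (xx , _) = irrefl G xx
    Gstar-irreflexive (suc i) = hat-irreflexive (Gi (suc i)) (part (suc i)) (Gi-irreflexive (suc i))

  in-part : ∀ {i u v} → part (suc i) ≡ [ u ] → v ∈ part (suc i) → v ≡ u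
  in-part P≡ v∈ with subst (_ ∈_) P≡ v∈
  ... | here v≡u = v≡u

  not-later : ∀ {i u x} → part (suc i) ≡ [ u ] → x ≢ u → ¬ Later k part (suc i) x → ¬ Later k part i x
  not-later P≡ x≢u ¬later (j , i<j , j≤k , x∈) with m≤n⇒m<n∨m≡n i<j
  ... | inj₁ i+1<j = ¬later (j , i+1<j , j≤k , x∈)
  ... | inj₂ refl  = x≢u (in-part P≡ x∈)

  vertex-drop : ∀ {i u x} → part (suc i) ≡ [ u ] → x ≢ u → V (Gi (suc i)) x → V (Gstar i) x
  vertex-drop P≡ x≢u (inj₁ xV) = xV
  vertex-drop P≡ x≢u (inj₂ x∈) = ⊥-elim (x≢u (in-part P≡ x∈))

  edge-drop : ∀ i {u x y} → part (suc i) ≡ [ u ] → x ≢ u → y ≢ u → V (Gi (suc i)) x → V (Gi (suc i)) y →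
    E (Gi (suc i)) x y → E (Gstar i) x y
  edge-drop _ _ _ _ _ _ (inj₁ xy) = xy
  edge-drop zero    P≡ x≢u y≢u xV yV (inj₂ (xy , _ , _)) = xy , vertex-drop P≡ x≢u xV , vertex-drop P≡ y≢u yV
  edge-drop (suc i) P≡ x≢u y≢u xV yV (inj₂ (xy , x-early , y-early)) =
    hat-mono (Gi (suc i)) (part (suc i)) (inj₂ (xy , not-later P≡ x≢u x-early , not-later P≡ y≢u y-early))

  covered : ∀ i {u} → part (suc i) ≡ [ u ] → Chordal (Gstar i) → ∀ (H : Hole (Gi (suc i))) → OnHole H u
  covered i {u} P≡ chordal H with any? (λ j → vs H j ≟ u)
  ... | yes onu = onu
  ... | no u∉H  = ⊥-elim (chordal (transferHole H (λ j → vertex-drop P≡ (avoid j) (inV H j)) λ a b →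
                    mk⇔ inj₁ (edge-drop i P≡ (avoid a) (avoid b) (inV H a) (inV H b))))
    where
    avoid : ∀ j → vs H j ≢ u
    avoid j e = u∉H (j , e)

  module _ (cover : ∀ (H : Hole (toGraph G)) → ∃ λ x → OnHole H x × x ∈ₛ C) where

    base : Chordal (Gstar zero)
    base H with cover (transferHole H (λ _ → tt) λ a b → mk⇔ (λ xy → xy , inV H a , inV H b) proj₁)
    ... | x , (j , vj≡x) , x∈C = inV H j (subst (_∈ₛ C) (sym vj≡x) x∈C)

    chordal : ∀ i → i ≤ k → Chordal (Gstar i)
    chordal zero    _   = base
    chordal (suc i) i<k with u , P≡ ← slot-singleton members i i<k =
      subst (λ us → Chordal (hat (Gi (suc i)) us)) (sym P≡)
        (chordalizeAt-chordal (Gi (suc i)) u (Gi-symmetric (suc i)) (Gi-irreflexive (suc i))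
          (inj₂ (subst (u ∈_) (sym P≡) (here refl)))
          (covered i P≡ (chordal i (≤-trans (n≤1+n i) i<k))))

    -- A single vertex on every hole is a hole cover with the NC property:
    -- there is no hole avoiding it, and a hole meets it at most once.
    stage : ∀ i → 1 ≤ i → i ≤ k →
      (HoleCover (Gi i) (_∈ part i) × NCSet (Gi i) (_∈ part i)) × Chordal (Gstar i)
    stage (suc i) _ i<k with u , P≡ ← slot-singleton members i i<k =
      (((u , u∈) , (λ _ x∈ → inj₂ x∈) , (λ H → u , onu H , u∈)) ,
       ((λ v v∈ H₁ H₂ _ v∉H₂ _ → v∉H₂ (subst (OnHole H₂) (sym (in-part P≡ v∈)) (onu H₂))) ,
        (λ H a b a∈ b∈ → trans (in-part P≡ a∈) (sym (in-part P≡ b∈))))) ,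
      chordal (suc i) i<k
      where
      u∈ : u ∈ part (suc i)
      u∈ = subst (u ∈_) (sym P≡) (here refl)
      onu : ∀ (H : Hole (Gi (suc i))) → OnHole H u
      onu = covered i P≡ (chordal i (≤-trans (n≤1+n i) i<k))

theorem4p1 : ∀ {n : ℕ} (G : SimpleGraph n) (C : Subset n) →
    HoleCover (toGraph G) (_∈ₛ C) →
    Σ ℕ λ k → Σ (ℕ → List (Fin n)) λ P →
      1 ≤ k × IsPartition C k P ×
      (∀ i → 1 ≤ i → i ≤ k →
        (HoleCover (Construction.Gi G C k P i) (_∈ P i) ×
         NCSet (Construction.Gi G C k P i) (_∈ P i)) ×
        Chordal (Construction.Gstar G C k P i))
theorem4p1 G C (C≠∅ , _ , cover) = k , part , nonempty C≠∅ , partition , stage cover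
  where open SingletonPartition G C
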